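{- A subgroup $\Lambda$ of $\mathbb{Z}\times\mathbb{Z}$ is treealisable if and only if either $\Lambda$ is two-dimensional (generated by two linearly independent vectors) or $\Lambda=\{(0,0)\}$.
   Context: A binary tree is a finite rooted plane tree in which every internal vertex has exactly two ordered children (left and right); $\mathcal{T}_n$ is the set of binary trees with $n$ leaves, leaves numbered $1,\dots,n$ from left to right. The left depth $\mathrm{ld}_T(i)$ (right depth $\mathrm{rd}_T(i)$) of a leaf $i$ is the number of steps to a left (right) child on the path from the root to $i$. For $T,T'\in\mathcal{T}_n$, $\Lambda_{T,T'}$ is the subgroup of $\mathbb{Z}\times\mathbb{Z}$ generated by $\{(\mathrm{ld}_T(i)-\mathrm{ld}_{T'}(i),\mathrm{rd}_T(i)-\mathrm{rd}_{T'}(i)):i=1,\dots,n\}$. A subgroup $\Lambda$ is treealisable if $\Lambda=\Lambda_{T,T'}$ for some $n\in\mathbb{N}_+$ and $T,T'\in\mathcal{T}_n$. -}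

module Defs where

open import Data.Nat using (ℕ; suc; _+_)
open import Data.Integer as ℤ using (ℤ; +_; 0ℤ) renaming (_+_ to _+ℤ_; _-_ to _-ℤ_; _*_ to _*ℤ_; -_ to -ℤ_)
open import Data.Product using (_×_; _,_; proj₁; proj₂; Σ; ∃; ∃-syntax)
open import Data.Fin using (Fin)
open import Data.Vec using (Vec; []; _∷_; _++_; map; lookup)
open import Relation.Binary.PropositionalEquality using (_≡_)
open import Relation.Nullary using (¬_)
open import Function.Bundles using (_⇔_)

data Tree : ℕ → Set where
  leaf : Tree 1
  node : ∀ {m n} → Tree m → Tree n → Tree (m + n)

-- depths T : Vec of (left depth, right depth) of the leaves 1..n, left to right.
depths : ∀ {n} → Tree n → Vec (ℕ × ℕ) n
depths leaf = (0 , 0) ∷ []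
depths (node l r) =
  map (λ p → (suc (proj₁ p) , proj₂ p)) (depths l) ++
  map (λ p → (proj₁ p , suc (proj₂ p))) (depths r)

ld : ∀ {n} → Tree n → Fin n → ℕ
ld T i = proj₁ (lookup (depths T) i)

rd : ∀ {n} → Tree n → Fin n → ℕ
rd T i = proj₂ (lookup (depths T) i)

ℤ² : Set
ℤ² = ℤ × ℤ

_⊕_ : ℤ² → ℤ² → ℤ²
(a , b) ⊕ (c , d) = (a +ℤ c , b +ℤ d)

⊖_ : ℤ² → ℤ²
⊖ (a , b) = (-ℤ a , -ℤ b)

record Subgroup : Set₁ where
  field
    mem : ℤ² → Set
    mem-zero : mem (0ℤ , 0ℤ)
    mem-add : ∀ {u v} → mem u → mem v → mem (u ⊕ v)
    mem-neg : ∀ {u} → mem u → mem (⊖ u)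
open Subgroup public

data Gen {I : Set} (S : I → ℤ²) : ℤ² → Set where
  gen  : ∀ i → Gen S (S i)
  gzero : Gen S (0ℤ , 0ℤ)
  gadd : ∀ {u v} → Gen S u → Gen S v → Gen S (u ⊕ v)
  gneg : ∀ {u} → Gen S u → Gen S (⊖ u)

⟨_⟩ : ∀ {I : Set} → (I → ℤ²) → Subgroup
⟨ S ⟩ = record { mem = Gen S ; mem-zero = gzero ; mem-add = gadd ; mem-neg = gneg }

_≐_ : Subgroup → Subgroup → Set
Λ ≐ Λ' = ∀ v → (mem Λ v ⇔ mem Λ' v)

Λ[_,_] : ∀ {n} → Tree n → Tree n → Subgroup
Λ[ T , T' ] = ⟨ (λ i → (+ ld T i -ℤ + ld T' i , + rd T i -ℤ + rd T' i)) ⟩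

Treealisable : Subgroup → Set
Treealisable Λ = ∃[ n ] Σ (Tree (suc n)) λ T → Σ (Tree (suc n)) λ T' → Λ ≐ Λ[ T , T' ]

LinIndep : ℤ² → ℤ² → Set
LinIndep (a , b) (c , d) = ¬ (a *ℤ d -ℤ b *ℤ c ≡ 0ℤ)

pair : ℤ² → ℤ² → ℕ → ℤ²
pair u v 0 = u
pair u v (suc _) = v

TwoDimensional : Subgroup → Set
TwoDimensional Λ = ∃[ u ] ∃[ v ] (LinIndep u v × (Λ ≐ ⟨ (λ (i : Fin 2) → pair u v (Data.Fin.toℕ i)) ⟩))

Trivial : Subgroup → Set
Trivial Λ = ∀ v → (mem Λ v ⇔ v ≡ (0ℤ , 0ℤ))

-- At the first leaf where the
-- depth sequences of two trees differ, both root paths have made the same number of right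
-- steps, so Λ[ T , T' ] contains a nonzero horizontal vector (x , 0); mirroring the trees
-- turns the last difference into a nonzero vertical vector (0 , y). A subgroup of ℤ²
-- containing both has a Hermite basis p, q = (0 , q₂) with p₁ q₂ ≢ 0, so it is
-- two-dimensional; equal depth sequences give the trivial subgroup.
--
-- Conversely, ⟨ u , v ⟩ contains c ℤ² for c = ∣ det (u , v) ∣, and modulo c ℤ² every vector
-- is congruent to some U = (m , - k) with m, k ≥ 0. Two explicit trees built from combs have
-- the difference sequence 0ᵏ, -e₁, (U - e₁)ᶜ⁻¹, U, (U + e₂)ᶜ⁻¹, e₂, 0ᵐ, where e₁ = (c , 0)
-- and e₂ = (0 , c), so they generate ⟨ U , e₁ , e₂ ⟩. Grafting the pairs for u and v under a
-- common root gives trees whose subgroup is ⟨ u , v ⟩.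

module Submission where

open import Defs
open import Data.Sum using (_⊎_; inj₁; inj₂; [_,_]′)
open import Data.Product using (_×_; _,_; proj₁; proj₂; Σ; ∃-syntax; Σ-syntax; swap)
open import Data.Nat as ℕ using (ℕ; zero; suc; _+_; _*_)
open import Data.Integer as ℤ using (ℤ; +_; 0ℤ; -[1+_]; +[1+_]; ∣_∣)
  renaming (_+_ to _+ℤ_; _-_ to _-ℤ_; _*_ to _*ℤ_; -_ to -ℤ_)
import Data.Integer.Properties as ℤP
import Data.Integer.DivMod as ℤD
import Data.Nat.Properties as ℕP
import Data.Integer.Tactic.RingSolver as ZT
open import Data.Fin using (Fin; zero; suc; toℕ)
open import Data.Vec as Vec using (Vec; []; _∷_; lookup; toList)
import Data.Vec.Properties as VP
open import Data.List as List using (List; []; _∷_; _++_; map; zipWith; length; reverse; _ʳ++_; replicate; applyUpTo)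
import Data.List.Properties as LP
open import Data.List.Membership.Propositional using (_∈_)
open import Data.List.Relation.Unary.Any using (here; there)
open import Data.List.Relation.Unary.All as All using (All; []; _∷_)
import Data.List.Relation.Unary.All.Properties as AllP
import Data.List.Relation.Unary.Any.Properties as Any
open import Data.List.Membership.Propositional.Properties using (∈-map⁺)
open import Relation.Binary.PropositionalEquality using (_≡_; refl; sym; trans; cong; cong₂; subst; subst₂; module ≡-Reasoning)
open import Relation.Nullary using (¬_; yes; no)
open import Data.Empty using (⊥-elim)
open import Function using (_∘_; id)
open import Function.Construct.Composition using (_⇔-∘_)
open import Function.Bundles using (_⇔_; mk⇔; Equivalence)

-- Subgroups of ℤ²

private variable
  I J : Set
  u v w : ℤ²

_⊆_ : Subgroup → Subgroup → Set
Λ ⊆ Λ' = ∀ {w} → mem Λ w → mem Λ' w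

⊆-antisym : {Λ Λ' : Subgroup} → Λ ⊆ Λ' → Λ' ⊆ Λ → Λ ≐ Λ'
⊆-antisym Λ⊆Λ' Λ'⊆Λ w = mk⇔ Λ⊆Λ' Λ'⊆Λ

≐-sym : {Λ Λ' : Subgroup} → Λ ≐ Λ' → Λ' ≐ Λ
≐-sym Λ≐Λ' w = mk⇔ (Equivalence.from (Λ≐Λ' w)) (Equivalence.to (Λ≐Λ' w))

≐-trans : {Λ Λ' Λ'' : Subgroup} → Λ ≐ Λ' → Λ' ≐ Λ'' → Λ ≐ Λ''
≐-trans Λ≐Λ' Λ'≐Λ'' w = mk⇔ (Equivalence.to (Λ'≐Λ'' w) ∘ Equivalence.to (Λ≐Λ' w))
                            (Equivalence.from (Λ≐Λ' w) ∘ Equivalence.from (Λ'≐Λ'' w))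

⟨⟩-least : (Λ : Subgroup) {S : I → ℤ²} → (∀ i → mem Λ (S i)) → ⟨ S ⟩ ⊆ Λ
⟨⟩-least Λ S⊆Λ (gen i)    = S⊆Λ i
⟨⟩-least Λ S⊆Λ gzero      = mem-zero Λ
⟨⟩-least Λ S⊆Λ (gadd x y) = mem-add Λ (⟨⟩-least Λ S⊆Λ x) (⟨⟩-least Λ S⊆Λ y)
⟨⟩-least Λ S⊆Λ (gneg x)   = mem-neg Λ (⟨⟩-least Λ S⊆Λ x)

⟨⟩-≐ : {S : I → ℤ²} {S' : J → ℤ²} →
       (∀ Λ → (∀ i → mem Λ (S i)) ⇔ (∀ j → mem Λ (S' j))) → ⟨ S ⟩ ≐ ⟨ S' ⟩
⟨⟩-≐ {S = S} {S'} same = ⊆-antisym {⟨ S ⟩} {⟨ S' ⟩} (⟨⟩-least ⟨ S' ⟩ (Equivalence.from (same ⟨ S' ⟩) gen))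
                                   (⟨⟩-least ⟨ S ⟩ (Equivalence.to (same ⟨ S ⟩) gen))

_⊙_ : ℤ → ℤ² → ℤ²
k ⊙ (a , b) = (k *ℤ a , k *ℤ b)

mem-scaleℕ : (Λ : Subgroup) (n : ℕ) {u : ℤ²} → mem Λ u → mem Λ ((+ n) ⊙ u)
mem-scaleℕ Λ zero    u∈Λ = mem-zero Λ
mem-scaleℕ Λ (suc n) {u = a , b} u∈Λ =
  subst (mem Λ) (cong₂ _,_ (1+n-scale a) (1+n-scale b)) (mem-add Λ u∈Λ (mem-scaleℕ Λ n u∈Λ))
  where
  1+n-scale : ∀ a → a +ℤ + n *ℤ a ≡ + suc n *ℤ a
  1+n-scale a = begin
    a +ℤ + n *ℤ a       ≡⟨ cong (_+ℤ + n *ℤ a) (sym (ℤP.*-identityˡ a)) ⟩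
    + 1 *ℤ a +ℤ + n *ℤ a ≡⟨ sym (ℤP.*-distribʳ-+ a (+ 1) (+ n)) ⟩
    + suc n *ℤ a        ∎
    where open ≡-Reasoning

mem-scale : (Λ : Subgroup) (k : ℤ) {u : ℤ²} → mem Λ u → mem Λ (k ⊙ u)
mem-scale Λ (+ n)    u∈Λ = mem-scaleℕ Λ n u∈Λ
mem-scale Λ -[1+ n ] {u = a , b} u∈Λ =
  subst (mem Λ) (cong₂ _,_ (ℤP.neg-distribˡ-* +[1+ n ] a) (ℤP.neg-distribˡ-* +[1+ n ] b))
        (mem-neg Λ (mem-scaleℕ Λ (suc n) u∈Λ))

reduce : ℤ → ℤ² → ℤ² → ℤ²
reduce k u v = u ⊕ (⊖ (k ⊙ v))

reduce-mem : (Λ : Subgroup) (k : ℤ) → mem Λ u → mem Λ v → mem Λ (reduce k u v)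
reduce-mem Λ k u∈Λ v∈Λ = mem-add Λ u∈Λ (mem-neg Λ (mem-scale Λ k v∈Λ))

unreduce-mem : (Λ : Subgroup) (k : ℤ) → mem Λ (reduce k u v) → mem Λ v → mem Λ u
unreduce-mem {u = a , b} {v = c , d} Λ k r∈Λ v∈Λ =
  subst (mem Λ) (cong₂ _,_ (cancel a (k *ℤ c)) (cancel b (k *ℤ d))) (mem-add Λ r∈Λ (mem-scale Λ k v∈Λ))
  where
  cancel : ∀ x y → x +ℤ -ℤ y +ℤ y ≡ x
  cancel x y = trans (ℤP.+-assoc x (-ℤ y) y) (trans (cong (x +ℤ_) (ℤP.+-inverseˡ y)) (ℤP.+-identityʳ x))

span₂ : ℤ² → ℤ² → Subgroup
span₂ u v = ⟨ (λ (i : Fin 2) → pair u v (toℕ i)) ⟩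

mem₂ : Subgroup → ℤ² × ℤ² → Set
mem₂ Λ (u , v) = mem Λ u × mem Λ v

span₂-least : (Λ : Subgroup) → mem₂ Λ (u , v) → span₂ u v ⊆ Λ
span₂-least Λ (u∈Λ , v∈Λ) = ⟨⟩-least Λ λ { zero → u∈Λ ; (suc zero) → v∈Λ }

Span : List ℤ² → Subgroup
Span xs = ⟨ (proj₁ {B = _∈ xs}) ⟩

Span-least : (Λ : Subgroup) {xs : List ℤ²} → All (mem Λ) xs → Span xs ⊆ Λ
Span-least Λ xs⊆Λ = ⟨⟩-least Λ λ (w , w∈xs) → All.lookup xs⊆Λ w∈xs

Span-mem : {xs : List ℤ²} → w ∈ xs → mem (Span xs) w
Span-mem {w = w} w∈xs = gen (w , w∈xs)

⟨⟩≐span₂ : {S : I → ℤ²} → (∀ Λ → (∀ i → mem Λ (S i)) ⇔ mem₂ Λ (u , v)) → ⟨ S ⟩ ≐ span₂ u v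
⟨⟩≐span₂ {u = u} {v} same = ⟨⟩-≐ λ Λ → mk⇔
  (λ S⊆Λ → pointwise {Λ} (Equivalence.to (same Λ) S⊆Λ))
  (λ uv⊆Λ → Equivalence.from (same Λ) (uv⊆Λ zero , uv⊆Λ (suc zero)))
  where
  pointwise : ∀ {Λ} → mem₂ Λ (u , v) → ∀ (i : Fin 2) → mem Λ (pair u v (toℕ i))
  pointwise (u∈Λ , v∈Λ) zero       = u∈Λ
  pointwise (u∈Λ , v∈Λ) (suc zero) = v∈Λ

Span≐span₂ : {xs : List ℤ²} →
             (∀ Λ → All (mem Λ) xs ⇔ mem₂ Λ (u , v)) → Span xs ≐ span₂ u v
Span≐span₂ same = ⟨⟩≐span₂ λ Λ → mk⇔
  (λ xs⊆Λ → Equivalence.to (same Λ) (All.tabulate λ w∈xs → xs⊆Λ (_ , w∈xs)))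
  (λ uv∈Λ (w , w∈xs) → All.lookup (Equivalence.from (same Λ) uv∈Λ) w∈xs)

origin : ℤ²
origin = 0ℤ , 0ℤ

zeroSubgroup : Subgroup
zeroSubgroup = record
  { mem      = _≡ origin
  ; mem-zero = refl
  ; mem-add  = cong₂ _⊕_
  ; mem-neg  = cong ⊖_
  }

vertical : Subgroup
vertical = record
  { mem      = λ w → proj₁ w ≡ 0ℤ
  ; mem-zero = refl
  ; mem-add  = cong₂ _+ℤ_
  ; mem-neg  = cong (λ x → -ℤ x)
  }

lineThrough : ℤ² → Subgroup
lineThrough (a , b) = record
  { mem      = λ (x , y) → x *ℤ b ≡ y *ℤ a
  ; mem-zero = refl
  ; mem-add  = λ {(x , y)} {(x' , y')} e e' → begin
      (x +ℤ x') *ℤ b    ≡⟨ ℤP.*-distribʳ-+ b x x' ⟩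
      x *ℤ b +ℤ x' *ℤ b ≡⟨ cong₂ _+ℤ_ e e' ⟩
      y *ℤ a +ℤ y' *ℤ a ≡⟨ ℤP.*-distribʳ-+ a y y' ⟨
      (y +ℤ y') *ℤ a    ∎
  ; mem-neg  = λ {(x , y)} e → begin
      -ℤ x *ℤ b    ≡⟨ ℤP.neg-distribˡ-* x b ⟨
      -ℤ (x *ℤ b)  ≡⟨ cong (λ t → -ℤ t) e ⟩
      -ℤ (y *ℤ a)  ≡⟨ ℤP.neg-distribˡ-* y a ⟩
      -ℤ y *ℤ a    ∎
  }
  where open ≡-Reasoning

axis₁ axis₂ : ℕ → ℤ²
axis₁ n = + n , 0ℤ
axis₂ n = 0ℤ , + n

posNeg : ℕ → ℕ → ℤ²
posNeg m k = + m , -ℤ + k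

-- Hermite bases

-- Euclid's algorithm on the π-coordinates of a pair of vectors; fuel ∣ π v ∣ suffices since the remainders decrease.
module Euclid (π : ℤ² → ℤ) (π-reduce : ∀ k u v → π (reduce k u v) ≡ π u -ℤ k *ℤ π v) where

  quotient : ∀ u v → ¬ π v ≡ 0ℤ → ℤ
  quotient u v πv≢0 = ℤ._/_ (π u) (π v) {{ℤ.≢-nonZero πv≢0}}

  π-remainder : ∀ u v (πv≢0 : ¬ π v ≡ 0ℤ) →
                π (reduce (quotient u v πv≢0) u v) ≡ + ℤ._%_ (π u) (π v) {{ℤ.≢-nonZero πv≢0}}
  π-remainder u v πv≢0 = begin
    π (reduce q u v)         ≡⟨ π-reduce q u v ⟩
    π u -ℤ q *ℤ π v          ≡⟨ cong (_-ℤ q *ℤ π v) (ℤD.a≡a%n+[a/n]*n (π u) (π v)) ⟩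
    + r +ℤ q *ℤ π v -ℤ q *ℤ π v ≡⟨ ℤP.+-assoc (+ r) (q *ℤ π v) (-ℤ (q *ℤ π v)) ⟩
    + r +ℤ (q *ℤ π v -ℤ q *ℤ π v) ≡⟨ cong (+ r +ℤ_) (ℤP.+-inverseʳ (q *ℤ π v)) ⟩
    + r +ℤ 0ℤ                ≡⟨ ℤP.+-identityʳ (+ r) ⟩
    + r                      ∎
    where
    open ≡-Reasoning
    instance _ = ℤ.≢-nonZero πv≢0
    q = quotient u v πv≢0
    r = ℤ._%_ (π u) (π v)

  euclid : ℕ → ℤ² → ℤ² → ℤ² × ℤ²
  euclid zero    u v = u , v
  euclid (suc f) u v with π v ℤ.≟ 0ℤ
  ... | yes _     = u , v
  ... | no πv≢0 = euclid f v (reduce (quotient u v πv≢0) u v)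

  euclid-mem : ∀ (Λ : Subgroup) f u v → mem₂ Λ (u , v) ⇔ mem₂ Λ (euclid f u v)
  euclid-mem Λ zero    u v = mk⇔ id id
  euclid-mem Λ (suc f) u v with π v ℤ.≟ 0ℤ
  ... | yes _     = mk⇔ id id
  ... | no πv≢0 = euclid-mem Λ f v (reduce q u v) ⇔-∘ mk⇔
    (λ (u∈Λ , v∈Λ) → v∈Λ , reduce-mem Λ q u∈Λ v∈Λ)
    (λ (v∈Λ , r∈Λ) → unreduce-mem Λ q r∈Λ v∈Λ , v∈Λ)
    where q = quotient u v πv≢0

  euclid-π-zero : ∀ f u v → ∣ π v ∣ ℕ.≤ f → π (proj₂ (euclid f u v)) ≡ 0ℤ
  euclid-π-zero zero    u v ∣πv∣≤0 = ℤP.∣i∣≡0⇒i≡0 (ℕP.n≤0⇒n≡0 ∣πv∣≤0)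
  euclid-π-zero (suc f) u v ∣πv∣≤1+f with π v ℤ.≟ 0ℤ
  ... | yes πv≡0  = πv≡0
  ... | no πv≢0 = euclid-π-zero f v (reduce (quotient u v πv≢0) u v)
    (subst (ℕ._≤ f) (sym (cong ∣_∣ (π-remainder u v πv≢0)))
      (ℕP.≤-pred (ℕP.≤-trans (ℤD.n%d<d (π u) (π v) {{ℤ.≢-nonZero πv≢0}}) ∣πv∣≤1+f)))

module Euclid₁ = Euclid proj₁ (λ _ _ _ → refl)
module Euclid₂ = Euclid proj₂ (λ _ _ _ → refl)

-- P Λ says that Λ contains a given generating family, which then generates the same subgroup as p and q.
record HermiteBasis (P : Subgroup → Set) : Set₁ where
  field
    p q        : ℤ²
    q-vertical : proj₁ q ≡ 0ℤ
    generates  : ∀ Λ → P Λ ⇔ mem₂ Λ (p , q)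

hermite-extend : ∀ p q w → proj₁ q ≡ 0ℤ → HermiteBasis (λ Λ → mem₂ Λ (p , q) × mem Λ w)
hermite-extend p q w q₁≡0 = record
  { p = p' ; q = q' ; q-vertical = proj₁ q',z-vertical
  ; generates = λ Λ → mk⇔
      (λ ((p∈Λ , q∈Λ) , w∈Λ) →
         let p'∈Λ , w'∈Λ = Equivalence.to (Euclid₁.euclid-mem Λ ∣ proj₁ w ∣ p w) (p∈Λ , w∈Λ)
         in p'∈Λ , proj₁ (Equivalence.to (Euclid₂.euclid-mem Λ ∣ proj₂ w' ∣ q w') (q∈Λ , w'∈Λ)))
      (λ (p'∈Λ , q'∈Λ) →
         let q∈Λ , w'∈Λ = Equivalence.from (Euclid₂.euclid-mem Λ ∣ proj₂ w' ∣ q w') (q'∈Λ , z∈ Λ)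
             p∈Λ , w∈Λ = Equivalence.from (Euclid₁.euclid-mem Λ ∣ proj₁ w ∣ p w) (p'∈Λ , w'∈Λ)
         in (p∈Λ , q∈Λ) , w∈Λ)
  }
  where
  p' w' q' z : ℤ²
  p' = proj₁ (Euclid₁.euclid ∣ proj₁ w ∣ p w)
  w' = proj₂ (Euclid₁.euclid ∣ proj₁ w ∣ p w)
  q' = proj₁ (Euclid₂.euclid ∣ proj₂ w' ∣ q w')
  z  = proj₂ (Euclid₂.euclid ∣ proj₂ w' ∣ q w')
  q',z-vertical : mem₂ vertical (q' , z)
  q',z-vertical = Equivalence.to (Euclid₂.euclid-mem vertical ∣ proj₂ w' ∣ q w')
                    (q₁≡0 , Euclid₁.euclid-π-zero ∣ proj₁ w ∣ p w ℕP.≤-refl)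
  z≡0 : z ≡ origin
  z≡0 = cong₂ _,_ (proj₂ q',z-vertical) (Euclid₂.euclid-π-zero ∣ proj₂ w' ∣ q w' ℕP.≤-refl)
  z∈ : ∀ Λ → mem Λ z
  z∈ Λ = subst (mem Λ) (sym z≡0) (mem-zero Λ)

hermite : ∀ N (S : Fin N → ℤ²) → HermiteBasis (λ Λ → ∀ i → mem Λ (S i))
hermite zero S = record
  { p = origin ; q = origin ; q-vertical = refl
  ; generates = λ Λ → mk⇔ (λ _ → mem-zero Λ , mem-zero Λ) (λ _ ()) }
hermite (suc N) S = record
  { HermiteBasis extended
  ; generates = λ Λ → HermiteBasis.generates extended Λ ⇔-∘ mk⇔
      (λ S⊆Λ → Equivalence.to (generates Λ) (S⊆Λ ∘ suc) , S⊆Λ zero)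
      (λ (pq∈Λ , S₀∈Λ) → λ { zero → S₀∈Λ ; (suc i) → Equivalence.from (generates Λ) pq∈Λ i })
  }
  where
  open HermiteBasis (hermite N (S ∘ suc))
  extended = hermite-extend p q (S zero) q-vertical

determinant : ℤ² → ℤ² → ℤ
determinant (a , b) (c , d) = a *ℤ d -ℤ b *ℤ c

-- The Hermite basis (p , q) has p₁ ≢ 0 because of the horizontal vector,
-- and q₂ ≢ 0 because otherwise the subgroup would lie on the line through p.
axes⇒TwoDimensional : ∀ {N} (S : Fin N → ℤ²) {x y : ℤ} →
                      ¬ x ≡ 0ℤ → mem ⟨ S ⟩ (x , 0ℤ) → ¬ y ≡ 0ℤ → mem ⟨ S ⟩ (0ℤ , y) →
                      TwoDimensional ⟨ S ⟩
axes⇒TwoDimensional {N} S {x} {y} x≢0 x∈ y≢0 y∈ =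
  p , q , det≢0 , ⟨⟩≐span₂ generates
  where
  open HermiteBasis (hermite N S)
  S⊆span : ⟨ S ⟩ ⊆ span₂ p q
  S⊆span = ⟨⟩-least (span₂ p q) (Equivalence.from (generates (span₂ p q)) (gen zero , gen (suc zero)))
  p₁≢0 : ¬ proj₁ p ≡ 0ℤ
  p₁≢0 p₁≡0 = x≢0 (span₂-least vertical (p₁≡0 , q-vertical) (S⊆span x∈))
  q₂≢0 : ¬ proj₂ q ≡ 0ℤ
  q₂≢0 q₂≡0 = [ y≢0 , p₁≢0 ]′
    (ℤP.i*j≡0⇒i≡0∨j≡0 y (sym (span₂-least (lineThrough p) (p-on-line , q-on-line) (S⊆span y∈))))
    where
    p-on-line : proj₁ p *ℤ proj₂ p ≡ proj₂ p *ℤ proj₁ p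
    p-on-line = ℤP.*-comm (proj₁ p) (proj₂ p)
    q-on-line : proj₁ q *ℤ proj₂ p ≡ proj₂ q *ℤ proj₁ p
    q-on-line = trans (cong (_*ℤ proj₂ p) q-vertical) (sym (cong (_*ℤ proj₁ p) q₂≡0))
  determinant≡p₁q₂ : determinant p q ≡ proj₁ p *ℤ proj₂ q
  determinant≡p₁q₂ = begin
    proj₁ p *ℤ proj₂ q -ℤ proj₂ p *ℤ proj₁ q  ≡⟨ cong (λ t → proj₁ p *ℤ proj₂ q -ℤ proj₂ p *ℤ t) q-vertical ⟩
    proj₁ p *ℤ proj₂ q -ℤ proj₂ p *ℤ 0ℤ       ≡⟨ cong (λ t → proj₁ p *ℤ proj₂ q -ℤ t) (ℤP.*-zeroʳ (proj₂ p)) ⟩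
    proj₁ p *ℤ proj₂ q -ℤ 0ℤ                  ≡⟨ ℤP.+-identityʳ _ ⟩
    proj₁ p *ℤ proj₂ q                        ∎
    where open ≡-Reasoning
  det≢0 : LinIndep p q
  det≢0 det≡0 = [ p₁≢0 , q₂≢0 ]′ (ℤP.i*j≡0⇒i≡0∨j≡0 (proj₁ p) (trans (sym determinant≡p₁q₂) det≡0))

TwoDimensional-resp-≐ : {Λ Λ' : Subgroup} → Λ ≐ Λ' → TwoDimensional Λ' → TwoDimensional Λ
TwoDimensional-resp-≐ {Λ} {Λ'} Λ≐Λ' (u , v , det≢0 , Λ'≐span) =
  u , v , det≢0 , ≐-trans {Λ} {Λ'} {span₂ u v} Λ≐Λ' Λ'≐span

-- Reduction modulo (1 + r) ℤ²

determinant-axes-mem : (Λ : Subgroup) (u v : ℤ²) → mem₂ Λ (u , v) →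
                       mem Λ (determinant u v , 0ℤ) × mem Λ (0ℤ , determinant u v)
determinant-axes-mem Λ u@(a , b) v@(c , d) (u∈ , v∈) =
  subst (mem Λ) (cong₂ _,_ (d·a-b·c a b c d) (d·b-b·d b d))
        (mem-add Λ (mem-scale Λ d u∈) (mem-neg Λ (mem-scale Λ b v∈))) ,
  subst (mem Λ) (cong₂ _,_ (-c·a+a·c a c) (-c·b+a·d a b c d))
        (mem-add Λ (mem-neg Λ (mem-scale Λ c u∈)) (mem-scale Λ a v∈))
  where
  d·a-b·c : ∀ a b c d → d *ℤ a +ℤ -ℤ (b *ℤ c) ≡ a *ℤ d -ℤ b *ℤ c
  d·a-b·c = ZT.solve-∀
  d·b-b·d : ∀ b d → d *ℤ b +ℤ -ℤ (b *ℤ d) ≡ 0ℤ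
  d·b-b·d = ZT.solve-∀
  -c·a+a·c : ∀ a c → -ℤ (c *ℤ a) +ℤ a *ℤ c ≡ 0ℤ
  -c·a+a·c = ZT.solve-∀
  -c·b+a·d : ∀ a b c d → -ℤ (c *ℤ b) +ℤ a *ℤ d ≡ a *ℤ d -ℤ b *ℤ c
  -c·b+a·d = ZT.solve-∀

-- Here 1 + r = ∣ determinant u v ∣.
full-sublattice : ∀ u v → LinIndep u v →
                  Σ[ r ∈ ℕ ] (∀ Λ → mem₂ Λ (u , v) → mem Λ (axis₁ (suc r)) × mem Λ (axis₂ (suc r)))
full-sublattice u v det≢0 = by-sign (determinant u v) det≢0 (λ Λ → determinant-axes-mem Λ u v)
  where
  by-sign : ∀ D → ¬ D ≡ 0ℤ → (∀ Λ → mem₂ Λ (u , v) → mem Λ (D , 0ℤ) × mem Λ (0ℤ , D)) →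
            Σ[ r ∈ ℕ ] (∀ Λ → mem₂ Λ (u , v) → mem Λ (axis₁ (suc r)) × mem Λ (axis₂ (suc r)))
  by-sign (+ zero)  D≢0 _      = ⊥-elim (D≢0 refl)
  by-sign +[1+ r ]  _   D-axes = r , D-axes
  by-sign -[1+ r ]  _   D-axes = r , λ Λ uv∈ → let d₁∈ , d₂∈ = D-axes Λ uv∈ in mem-neg Λ d₁∈ , mem-neg Λ d₂∈

lift : ℕ → ℤ → ℕ
lift r (+ n)    = n + suc r * n
lift r -[1+ n ] = r * suc n

+lift : ∀ r z → + lift r z ≡ z +ℤ + suc r *ℤ + ∣ z ∣
+lift r (+ n)    = trans (ℤP.pos-+ n (suc r * n)) (cong (+ n +ℤ_) (ℤP.pos-* (suc r) n))
+lift r -[1+ n ] = sym (begin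
  -[1+ n ] +ℤ + suc r *ℤ + suc n         ≡⟨ cong (-[1+ n ] +ℤ_) (ℤP.pos-* (suc r) (suc n)) ⟨
  -[1+ n ] +ℤ + (suc n + r * suc n)      ≡⟨ cong (-[1+ n ] +ℤ_) (ℤP.pos-+ (suc n) (r * suc n)) ⟩
  -[1+ n ] +ℤ (+ suc n +ℤ + (r * suc n)) ≡⟨ ℤP.+-assoc -[1+ n ] (+ suc n) (+ (r * suc n)) ⟨
  -[1+ n ] +ℤ + suc n +ℤ + (r * suc n)   ≡⟨ cong (_+ℤ + (r * suc n)) (ℤP.+-inverseˡ (+ suc n)) ⟩
  0ℤ +ℤ + (r * suc n)                    ≡⟨ ℤP.+-identityˡ (+ (r * suc n)) ⟩
  + (r * suc n)                          ∎)
  where open ≡-Reasoning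

-- A representative of w modulo (1 + r) ℤ² in the quadrant of posNeg.
representative : ℕ → ℤ² → ℤ²
representative r (a , b) = posNeg (lift r a) (lift r (-ℤ b))

representative-mem : (Λ : Subgroup) (r : ℕ) (w : ℤ²) → mem Λ (axis₁ (suc r)) → mem Λ (axis₂ (suc r)) →
                     mem Λ w ⇔ mem Λ (representative r w)
representative-mem Λ r w@(a , b) e₁∈ e₂∈ = mk⇔
  (λ w∈ → subst (mem Λ) (sym rep≡) (reduce-mem Λ (-ℤ + ∣ a ∣) (reduce-mem Λ (+ ∣ b ∣) w∈ e₂∈) e₁∈))
  (λ rep∈ → unreduce-mem Λ (+ ∣ b ∣) (unreduce-mem Λ (-ℤ + ∣ a ∣) (subst (mem Λ) rep≡ rep∈) e₁∈) e₂∈)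
  where
  c = + suc r
  rep≡ : representative r w ≡ reduce (-ℤ + ∣ a ∣) (reduce (+ ∣ b ∣) w (axis₂ (suc r))) (axis₁ (suc r))
  rep≡ = cong₂ _,_
    (trans (+lift r a) (first-coordinate a (+ ∣ a ∣) (+ ∣ b ∣) c))
    (trans (cong (λ t → -ℤ t) (trans (+lift r (-ℤ b)) (cong (λ n → -ℤ b +ℤ c *ℤ + n) (ℤP.∣-i∣≡∣i∣ b))))
           (second-coordinate b (+ ∣ b ∣) (+ ∣ a ∣) c))
    where
    first-coordinate : ∀ a A B c → a +ℤ c *ℤ A ≡ (a -ℤ B *ℤ 0ℤ) -ℤ (-ℤ A) *ℤ c
    first-coordinate = ZT.solve-∀
    second-coordinate : ∀ b B A c → -ℤ (-ℤ b +ℤ c *ℤ B) ≡ (b -ℤ B *ℤ c) -ℤ (-ℤ A) *ℤ 0ℤ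
    second-coordinate = ZT.solve-∀

-- Depth sequences

Depth : Set
Depth = ℕ × ℕ

stepL stepR : Depth → Depth
stepL (a , b) = (suc a , b)
stepR (a , b) = (a , suc b)

depthList : ∀ {n} → Tree n → List Depth
depthList leaf       = (0 , 0) ∷ []
depthList (node l r) = map stepL (depthList l) ++ map stepR (depthList r)

toList-depths : ∀ {n} (T : Tree n) → toList (depths T) ≡ depthList T
toList-depths leaf       = refl
toList-depths (node l r) = begin
  toList (Vec.map stepL (depths l) Vec.++ Vec.map stepR (depths r))
    ≡⟨ VP.toList-++ (Vec.map stepL (depths l)) (Vec.map stepR (depths r)) ⟩
  toList (Vec.map stepL (depths l)) ++ toList (Vec.map stepR (depths r))
    ≡⟨ cong₂ _++_ (VP.toList-map stepL (depths l)) (VP.toList-map stepR (depths r)) ⟩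
  map stepL (toList (depths l)) ++ map stepR (toList (depths r))
    ≡⟨ cong₂ (λ xs ys → map stepL xs ++ map stepR ys) (toList-depths l) (toList-depths r) ⟩
  depthList (node l r) ∎
  where open ≡-Reasoning

length-depthList : ∀ {n} (T : Tree n) → length (depthList T) ≡ n
length-depthList T = trans (cong length (sym (toList-depths T))) (VP.length-toList (depths T))

δ : Depth → Depth → ℤ²
δ (a , b) (a' , b') = (+ a -ℤ + a' , + b -ℤ + b')

diffs : List Depth → List Depth → List ℤ²
diffs = zipWith δ

δ-lookup-∈ : ∀ {n} (A B : Vec Depth n) i → δ (lookup A i) (lookup B i) ∈ diffs (toList A) (toList B)
δ-lookup-∈ (a ∷ A) (b ∷ B) zero    = here refl
δ-lookup-∈ (a ∷ A) (b ∷ B) (suc i) = there (δ-lookup-∈ A B i)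

∈-diffs-lookup : ∀ {n} (A B : Vec Depth n) → w ∈ diffs (toList A) (toList B) →
                 ∃[ i ] δ (lookup A i) (lookup B i) ≡ w
∈-diffs-lookup (a ∷ A) (b ∷ B) (here refl) = zero , refl
∈-diffs-lookup (a ∷ A) (b ∷ B) (there w∈) with i , eq ← ∈-diffs-lookup A B w∈ = suc i , eq

treeDiffs : ∀ {m n} → Tree m → Tree n → List ℤ²
treeDiffs T T' = diffs (depthList T) (depthList T')

Λ≐Span-treeDiffs : ∀ {n} (T T' : Tree n) → Λ[ T , T' ] ≐ Span (treeDiffs T T')
Λ≐Span-treeDiffs T T' = ⊆-antisym {Λ[ T , T' ]} {Span (treeDiffs T T')}
  (⟨⟩-least (Span (treeDiffs T T')) λ i → Span-mem (toList→depthList (δ-lookup-∈ (depths T) (depths T') i)))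
  (Span-least Λ[ T , T' ] (All.tabulate λ w∈ →
    let i , eq = ∈-diffs-lookup (depths T) (depths T') (depthList→toList w∈)
    in subst (mem Λ[ T , T' ]) eq (gen i)))
  where
  toList→depthList : w ∈ diffs (toList (depths T)) (toList (depths T')) → w ∈ treeDiffs T T'
  toList→depthList = subst₂ (λ xs ys → _ ∈ diffs xs ys) (toList-depths T) (toList-depths T')
  depthList→toList : w ∈ treeDiffs T T' → w ∈ diffs (toList (depths T)) (toList (depths T'))
  depthList→toList = subst₂ (λ xs ys → _ ∈ diffs xs ys) (sym (toList-depths T)) (sym (toList-depths T'))

treeGenerators : ∀ {n} → Tree n → Tree n → Fin n → ℤ²
treeGenerators T T' i = δ (lookup (depths T) i) (lookup (depths T') i)

δ-stepL : ∀ a b → δ (stepL a) (stepL b) ≡ δ a b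
δ-stepL (a , b) (a' , b') = cong (_, + b -ℤ + b') (suc-cancel a a')
  where
  suc-cancel : ∀ m n → + suc m -ℤ + suc n ≡ + m -ℤ + n
  suc-cancel m n = trans (ℤP.[1+m]⊖[1+n]≡m⊖n m n) (sym (ℤP.m-n≡m⊖n m n))

δ-stepR : ∀ a b → δ (stepR a) (stepR b) ≡ δ a b
δ-stepR a b = begin
  δ (stepR a) (stepR b)                       ≡⟨⟩
  swap (δ (stepL (swap a)) (stepL (swap b)))  ≡⟨ cong swap (δ-stepL (swap a) (swap b)) ⟩
  δ a b                                       ∎
  where open ≡-Reasoning

diffs-map-invariant : ∀ {s : Depth → Depth} → (∀ a b → δ (s a) (s b) ≡ δ a b) →
            ∀ xs ys → diffs (map s xs) (map s ys) ≡ diffs xs ys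
diffs-map-invariant {s} δ-s xs ys = trans (LP.zipWith-map δ s s xs ys) (LP.zipWith-cong δ-s xs ys)

module _ {A B C : Set} (f : A → B → C) where

  ∈-zipWith-++ˡ : ∀ {c : C} {xs : List A} {ys : List B} xs' ys' →
                  c ∈ zipWith f xs ys → c ∈ zipWith f (xs ++ xs') (ys ++ ys')
  ∈-zipWith-++ˡ {xs = x ∷ xs} {y ∷ ys} xs' ys' (here eq) = here eq
  ∈-zipWith-++ˡ {xs = x ∷ xs} {y ∷ ys} xs' ys' (there c∈) = there (∈-zipWith-++ˡ xs' ys' c∈)

  zipWith-ʳ++ : ∀ {xs : List A} {ys : List B} as bs → length xs ≡ length ys →
                zipWith f (xs ʳ++ as) (ys ʳ++ bs) ≡ zipWith f xs ys ʳ++ zipWith f as bs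
  zipWith-ʳ++ {[]}     {[]}     as bs eq = refl
  zipWith-ʳ++ {x ∷ xs} {y ∷ ys} as bs eq = zipWith-ʳ++ {xs} {ys} (x ∷ as) (y ∷ bs) (ℕP.suc-injective eq)

  zipWith-reverse : ∀ {xs : List A} {ys : List B} → length xs ≡ length ys →
                    zipWith f (reverse xs) (reverse ys) ≡ reverse (zipWith f xs ys)
  zipWith-reverse {xs} {ys} = zipWith-ʳ++ {xs} {ys} [] []

∈-zipWith-++ʳ : ∀ {A C : Set} (f : A → A → C) {c : C} (xs : List A) {ys ys' : List A} →
                c ∈ zipWith f ys ys' → c ∈ zipWith f (xs ++ ys) (xs ++ ys')
∈-zipWith-++ʳ f []       c∈ = c∈
∈-zipWith-++ʳ f (x ∷ xs) c∈ = there (∈-zipWith-++ʳ f xs c∈)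

diffs-++ : ∀ {xs xs' : List Depth} ys ys' → length xs ≡ length xs' →
           diffs (xs ++ ys) (xs' ++ ys') ≡ diffs xs xs' ++ diffs ys ys'
diffs-++ {[]}     {[]}      ys ys' eq = refl
diffs-++ {x ∷ xs} {x' ∷ xs'} ys ys' eq = cong (δ x x' ∷_) (diffs-++ ys ys' (ℕP.suc-injective eq))

diffs-self : ∀ xs → diffs xs xs ≡ replicate (length xs) origin
diffs-self []             = refl
diffs-self ((a , b) ∷ xs) = cong₂ _∷_ (cong₂ _,_ (ℤP.+-inverseʳ (+ a)) (ℤP.+-inverseʳ (+ b))) (diffs-self xs)

diffs-applyUpTo : ∀ {f g : ℕ → Depth} {c} → (∀ j → δ (f j) (g j) ≡ c) →
                  ∀ n → diffs (applyUpTo f n) (applyUpTo g n) ≡ replicate n c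
diffs-applyUpTo δ≡c zero    = refl
diffs-applyUpTo δ≡c (suc n) = cong₂ _∷_ (δ≡c 0) (diffs-applyUpTo (δ≡c ∘ suc) n)

diffs-map-const : ∀ {f g : Depth → Depth} {c} → (∀ z → δ (f z) (g z) ≡ c) →
                  ∀ zs → diffs (map f zs) (map g zs) ≡ replicate (length zs) c
diffs-map-const δ≡c []       = refl
diffs-map-const δ≡c (z ∷ zs) = cong₂ _∷_ (δ≡c z) (diffs-map-const δ≡c zs)

⊖-cong : ∀ a a' p p' → a + p' ≡ p + a' → + a -ℤ + a' ≡ + p -ℤ + p'
⊖-cong a a' p p' eq = begin
  + a -ℤ + a'                      ≡⟨ add-both (+ a) (+ a') (+ p') ⟩
  (+ a +ℤ + p') -ℤ (+ a' +ℤ + p')  ≡⟨ cong₂ _-ℤ_ (ℤP.pos-+ a p') (ℤP.pos-+ a' p') ⟨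
  + (a + p') -ℤ + (a' + p')        ≡⟨ cong₂ (λ s t → + s -ℤ + t) eq (ℕP.+-comm a' p') ⟩
  + (p + a') -ℤ + (p' + a')        ≡⟨ cong₂ _-ℤ_ (ℤP.pos-+ p a') (ℤP.pos-+ p' a') ⟩
  (+ p +ℤ + a') -ℤ (+ p' +ℤ + a')  ≡⟨ add-both (+ p) (+ p') (+ a') ⟨
  + p -ℤ + p'                      ∎
  where
  open ≡-Reasoning
  add-both : ∀ (x y z : ℤ) → x -ℤ y ≡ (x +ℤ z) -ℤ (y +ℤ z)
  add-both = ZT.solve-∀

δ-cong : ∀ (x y : Depth) p q p' q' → proj₁ x + p' ≡ p + proj₁ y → proj₂ x + q' ≡ q + proj₂ y →
         δ x y ≡ δ (p , q) (p' , q')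
δ-cong (a , b) (a' , b') p q p' q' eq₁ eq₂ = cong₂ _,_ (⊖-cong a a' p p' eq₁) (⊖-cong b b' q q' eq₂)

depthList-subst : ∀ {m n} (eq : m ≡ n) (T : Tree m) → depthList (subst Tree eq T) ≡ depthList T
depthList-subst refl T = refl

diffs-node : ∀ {m n m' n'} (l : Tree m) (r : Tree n) (l' : Tree m') (r' : Tree n') →
             length (depthList l) ≡ length (depthList l') →
             treeDiffs (node l r) (node l' r') ≡ treeDiffs l l' ++ treeDiffs r r'
diffs-node l r l' r' |l|≡|l'| = begin
  diffs (map stepL (depthList l) ++ map stepR (depthList r)) (map stepL (depthList l') ++ map stepR (depthList r'))
    ≡⟨ diffs-++ (map stepR (depthList r)) (map stepR (depthList r'))
                (trans (LP.length-map stepL (depthList l)) (trans |l|≡|l'| (sym (LP.length-map stepL (depthList l'))))) ⟩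
  diffs (map stepL (depthList l)) (map stepL (depthList l')) ++ diffs (map stepR (depthList r)) (map stepR (depthList r'))
    ≡⟨ cong₂ _++_ (diffs-map-invariant {stepL} δ-stepL (depthList l) (depthList l'))
                  (diffs-map-invariant {stepR} δ-stepR (depthList r) (depthList r')) ⟩
  treeDiffs l l' ++ treeDiffs r r' ∎
  where open ≡-Reasoning

firstLeaf : ∀ {n} (T : Tree n) → ∃[ x ] ∃[ rest ] depthList T ≡ (x , 0) ∷ rest
firstLeaf leaf = 0 , [] , refl
firstLeaf (node l r) with x , rest , eq ← firstLeaf l =
  suc x , map stepL rest ++ map stepR (depthList r) , cong (λ xs → map stepL xs ++ map stepR (depthList r)) eq

treealisable-by : ∀ {Λ s s'} (T : Tree s) (T' : Tree s') → length (depthList T) ≡ length (depthList T') →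
                  Λ ≐ Span (treeDiffs T T') → Treealisable Λ
treealisable-by {Λ} {s} {s'} T T' |T|≡|T'| Λ≐Span with firstLeaf T
... | _ , rest , depthList≡ =
  length rest , T₀ , T₀' , ≐-trans {Λ} {Span (treeDiffs T T')} {Λ[ T₀ , T₀' ]} Λ≐Span Span≐Λ
  where
  s≡ : s ≡ suc (length rest)
  s≡ = trans (sym (length-depthList T)) (cong length depthList≡)
  s'≡ : s' ≡ suc (length rest)
  s'≡ = trans (sym (length-depthList T')) (trans (sym |T|≡|T'|) (cong length depthList≡))
  T₀ T₀' : Tree (suc (length rest))
  T₀  = subst Tree s≡ T
  T₀' = subst Tree s'≡ T'
  Span≐Λ : Span (treeDiffs T T') ≐ Λ[ T₀ , T₀' ]
  Span≐Λ = subst (λ ws → Span ws ≐ Λ[ T₀ , T₀' ]) (cong₂ diffs (depthList-subst s≡ T) (depthList-subst s'≡ T'))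
                 (≐-sym {Λ[ T₀ , T₀' ]} {Span (treeDiffs T₀ T₀')} (Λ≐Span-treeDiffs T₀ T₀'))

-- Treealisable subgroups are two-dimensional or trivial

HasHorizontal HasVertical : List ℤ² → Set
HasHorizontal ws = ∃[ x ] ¬ x ≡ 0ℤ × (x , 0ℤ) ∈ ws
HasVertical   ws = ∃[ y ] ¬ y ≡ 0ℤ × (0ℤ , y) ∈ ws

δ-≢ : ∀ a b c → ¬ a ≡ b → ¬ proj₁ (δ (a , c) (b , c)) ≡ 0ℤ
δ-≢ a b c a≢b eq = a≢b (ℤP.+-injective (ℤP.i-j≡0⇒i≡j (+ a) (+ b) eq))

δ-sameRight : ∀ a b c → δ (a , c) (b , c) ≡ (proj₁ (δ (a , c) (b , c)) , 0ℤ)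
δ-sameRight a b c = cong (_ ,_) (ℤP.+-inverseʳ (+ c))

firstDifference : ∀ {m n} (T : Tree m) (T' : Tree n) →
                  depthList T ≡ depthList T' ⊎ HasHorizontal (treeDiffs T T')
firstDifference leaf leaf = inj₁ refl
firstDifference leaf (node l r) with x , rest , eq ← firstLeaf l rewrite eq =
  inj₂ (_ , δ-≢ 0 (suc x) 0 (λ ()) , here (δ-sameRight 0 (suc x) 0))
firstDifference (node l r) leaf with x , rest , eq ← firstLeaf l rewrite eq =
  inj₂ (_ , δ-≢ (suc x) 0 0 (λ ()) , here (δ-sameRight (suc x) 0 0))
firstDifference (node l r) (node l' r') with firstDifference l l'
... | inj₂ (x , x≢0 , x∈) =
  inj₂ (x , x≢0 , ∈-zipWith-++ˡ δ (map stepR (depthList r)) (map stepR (depthList r'))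
                    (subst ((x , 0ℤ) ∈_) (sym (diffs-map-invariant {stepL} δ-stepL (depthList l) (depthList l'))) x∈))
... | inj₁ eqˡ with firstDifference r r'
...   | inj₁ eqʳ = inj₁ (cong₂ (λ xs ys → map stepL xs ++ map stepR ys) eqˡ eqʳ)
...   | inj₂ (x , x≢0 , x∈) rewrite eqˡ =
  inj₂ (x , x≢0 , ∈-zipWith-++ʳ δ (map stepL (depthList l'))
                    (subst ((x , 0ℤ) ∈_) (sym (diffs-map-invariant {stepR} δ-stepR (depthList r) (depthList r'))) x∈))

mirror : ∀ {n} → Tree n → Tree n
mirror leaf                   = leaf
mirror (node {m} {n} l r) = subst Tree (ℕP.+-comm n m) (node (mirror r) (mirror l))

map-swap-depthList-mirror : ∀ {n} (T : Tree n) → map swap (depthList (mirror T)) ≡ reverse (depthList T)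
map-swap-depthList-mirror leaf = refl
map-swap-depthList-mirror (node {m} {n} l r) = begin
  map swap (depthList (mirror (node l r)))
    ≡⟨ cong (map swap) (depthList-subst (ℕP.+-comm n m) (node (mirror r) (mirror l))) ⟩
  map swap (map stepL (depthList (mirror r)) ++ map stepR (depthList (mirror l)))
    ≡⟨ LP.map-++ swap (map stepL (depthList (mirror r))) _ ⟩
  map swap (map stepL (depthList (mirror r))) ++ map swap (map stepR (depthList (mirror l)))
    ≡⟨ cong₂ _++_ (swap-stepL (depthList (mirror r))) (swap-stepR (depthList (mirror l))) ⟩
  map stepR (map swap (depthList (mirror r))) ++ map stepL (map swap (depthList (mirror l)))
    ≡⟨ cong₂ (λ xs ys → map stepR xs ++ map stepL ys) (map-swap-depthList-mirror r) (map-swap-depthList-mirror l) ⟩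
  map stepR (reverse (depthList r)) ++ map stepL (reverse (depthList l))
    ≡⟨ cong₂ _++_ (LP.reverse-map stepR (depthList r)) (LP.reverse-map stepL (depthList l)) ⟩
  reverse (map stepR (depthList r)) ++ reverse (map stepL (depthList l))
    ≡⟨ LP.reverse-++ (map stepL (depthList l)) (map stepR (depthList r)) ⟨
  reverse (depthList (node l r)) ∎
  where
  open ≡-Reasoning
  swap-stepL : ∀ xs → map swap (map stepL xs) ≡ map stepR (map swap xs)
  swap-stepL xs = trans (sym (LP.map-∘ xs)) (LP.map-∘ xs)
  swap-stepR : ∀ xs → map swap (map stepR xs) ≡ map stepL (map swap xs)
  swap-stepR xs = trans (sym (LP.map-∘ xs)) (LP.map-∘ xs)

map-swap-treeDiffs-mirror : ∀ {n} (T T' : Tree n) →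
                            map swap (treeDiffs (mirror T) (mirror T')) ≡ reverse (treeDiffs T T')
map-swap-treeDiffs-mirror {n} T T' = begin
  map swap (diffs (depthList (mirror T)) (depthList (mirror T')))
    ≡⟨ LP.map-zipWith δ swap (depthList (mirror T)) (depthList (mirror T')) ⟩
  zipWith (λ a b → δ (swap a) (swap b)) (depthList (mirror T)) (depthList (mirror T'))
    ≡⟨ LP.zipWith-map δ swap swap (depthList (mirror T)) (depthList (mirror T')) ⟨
  diffs (map swap (depthList (mirror T))) (map swap (depthList (mirror T')))
    ≡⟨ cong₂ diffs (map-swap-depthList-mirror T) (map-swap-depthList-mirror T') ⟩
  diffs (reverse (depthList T)) (reverse (depthList T'))
    ≡⟨ zipWith-reverse δ {depthList T} {depthList T'} (trans (length-depthList T) (sym (length-depthList T'))) ⟩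
  reverse (treeDiffs T T') ∎
  where open ≡-Reasoning

lastDifference : ∀ {n} (T T' : Tree n) → depthList T ≡ depthList T' ⊎ HasVertical (treeDiffs T T')
lastDifference T T' with firstDifference (mirror T) (mirror T')
... | inj₁ eq = inj₁ (LP.reverse-injective (begin
  reverse (depthList T)            ≡⟨ map-swap-depthList-mirror T ⟨
  map swap (depthList (mirror T))  ≡⟨ cong (map swap) eq ⟩
  map swap (depthList (mirror T')) ≡⟨ map-swap-depthList-mirror T' ⟩
  reverse (depthList T')           ∎))
  where open ≡-Reasoning
... | inj₂ (y , y≢0 , y∈) = inj₂ (y , y≢0 , Any.reverse⁻
  (subst ((0ℤ , y) ∈_) (map-swap-treeDiffs-mirror T T') (∈-map⁺ swap y∈)))

equalDepths⇒Trivial : ∀ {Λ n} (T T' : Tree n) → Λ ≐ Λ[ T , T' ] → depthList T ≡ depthList T' → Trivial Λ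
equalDepths⇒Trivial {Λ} T T' Λ≐ eq v = mk⇔
  (λ v∈Λ → Span-least zeroSubgroup
             (subst (λ xs → All (mem zeroSubgroup) (diffs xs (depthList T'))) (sym eq)
                    (subst (All (mem zeroSubgroup)) (sym (diffs-self (depthList T'))) (AllP.replicate⁺ _ refl)))
             (Equivalence.to (Λ≐Span-treeDiffs T T' v) (Equivalence.to (Λ≐ v) v∈Λ)))
  (λ v≡0 → subst (mem Λ) (sym v≡0) (mem-zero Λ))

treealisable⇒ : (Λ : Subgroup) → Treealisable Λ → TwoDimensional Λ ⊎ Trivial Λ
treealisable⇒ Λ (n , T , T' , Λ≐) with firstDifference T T' | lastDifference T T'
... | inj₁ eq | _       = inj₂ (equalDepths⇒Trivial {Λ} T T' Λ≐ eq)
... | inj₂ _  | inj₁ eq = inj₂ (equalDepths⇒Trivial {Λ} T T' Λ≐ eq)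
... | inj₂ (x , x≢0 , x∈) | inj₂ (y , y≢0 , y∈) =
  inj₁ (TwoDimensional-resp-≐ {Λ} {Λ[ T , T' ]} Λ≐
         (axes⇒TwoDimensional (treeGenerators T T') x≢0 (inΛ x∈) y≢0 (inΛ y∈)))
  where
  inΛ : w ∈ treeDiffs T T' → mem Λ[ T , T' ] w
  inΛ {w} w∈ = Equivalence.from (Λ≐Span-treeDiffs T T' w) (Span-mem w∈)

-- Two-dimensional subgroups are treealisable

STree : Set
STree = Σ ℕ Tree

_⋆_ : STree → STree → STree
(m , l) ⋆ (n , r) = m + n , node l r

leaf₁ : STree
leaf₁ = 1 , leaf

depthsₛ : STree → List Depth
depthsₛ (_ , T) = depthList T

rightComb leftComb : ℕ → STree → STree
rightComb zero    X = X
rightComb (suc k) X = leaf₁ ⋆ rightComb k X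
leftComb zero    X = X
leftComb (suc m) X = leftComb m X ⋆ leaf₁

shift : Depth → Depth → Depth
shift (a , b) (p , q) = (a + p , b + q)

rightLeaves : ℕ → List Depth
rightLeaves zero    = []
rightLeaves (suc m) = map stepL (rightLeaves m) ++ (0 , 1) ∷ []

length-rightLeaves : ∀ m → length (rightLeaves m) ≡ m
length-rightLeaves zero    = refl
length-rightLeaves (suc m) = begin
  length (map stepL (rightLeaves m) ++ (0 , 1) ∷ [])  ≡⟨ LP.length-++ (map stepL (rightLeaves m)) ⟩
  length (map stepL (rightLeaves m)) + 1              ≡⟨ cong (_+ 1) (LP.length-map stepL (rightLeaves m)) ⟩
  length (rightLeaves m) + 1                          ≡⟨ cong (_+ 1) (length-rightLeaves m) ⟩
  m + 1                                               ≡⟨ ℕP.+-comm m 1 ⟩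
  suc m                                               ∎
  where open ≡-Reasoning

depths-rightComb : ∀ k X → depthsₛ (rightComb k X) ≡ applyUpTo (1 ,_) k ++ map (shift (0 , k)) (depthsₛ X)
depths-rightComb zero    X = sym (LP.map-id (depthsₛ X))
depths-rightComb (suc k) X = cong ((1 , 0) ∷_) (begin
  map stepR (depthsₛ (rightComb k X))
    ≡⟨ cong (map stepR) (depths-rightComb k X) ⟩
  map stepR (applyUpTo (1 ,_) k ++ map (shift (0 , k)) (depthsₛ X))
    ≡⟨ LP.map-++ stepR (applyUpTo (1 ,_) k) _ ⟩
  map stepR (applyUpTo (1 ,_) k) ++ map stepR (map (shift (0 , k)) (depthsₛ X))
    ≡⟨ cong₂ _++_ (LP.map-applyUpTo (1 ,_) stepR k) (sym (LP.map-∘ (depthsₛ X))) ⟩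
  applyUpTo (λ j → 1 , suc j) k ++ map (shift (0 , suc k)) (depthsₛ X) ∎)
  where open ≡-Reasoning

depths-leftComb : ∀ m X → depthsₛ (leftComb m X) ≡ map (shift (m , 0)) (depthsₛ X) ++ rightLeaves m
depths-leftComb zero    X = sym (trans (LP.++-identityʳ _) (LP.map-id (depthsₛ X)))
depths-leftComb (suc m) X = begin
  map stepL (depthsₛ (leftComb m X)) ++ (0 , 1) ∷ []
    ≡⟨ cong (λ xs → map stepL xs ++ (0 , 1) ∷ []) (depths-leftComb m X) ⟩
  map stepL (map (shift (m , 0)) (depthsₛ X) ++ rightLeaves m) ++ (0 , 1) ∷ []
    ≡⟨ cong (_++ (0 , 1) ∷ []) (LP.map-++ stepL (map (shift (m , 0)) (depthsₛ X)) (rightLeaves m)) ⟩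
  (map stepL (map (shift (m , 0)) (depthsₛ X)) ++ map stepL (rightLeaves m)) ++ (0 , 1) ∷ []
    ≡⟨ LP.++-assoc (map stepL (map (shift (m , 0)) (depthsₛ X))) _ _ ⟩
  map stepL (map (shift (m , 0)) (depthsₛ X)) ++ rightLeaves (suc m)
    ≡⟨ cong (_++ rightLeaves (suc m)) (LP.map-∘ (depthsₛ X)) ⟨
  map (shift (suc m , 0)) (depthsₛ X) ++ rightLeaves (suc m) ∎
  where open ≡-Reasoning

segments : {X : Set} → List X → X → List X → X → List X → X → List X → List X
segments A x L y L' z B = A ++ x ∷ (L ++ y ∷ (L' ++ z ∷ B))

diffs-segments : ∀ A {x x' y y' z z'} {L M L' M'} B → length L ≡ length M → length L' ≡ length M' →
                 diffs (segments A x L y L' z B) (segments A x' M y' M' z' B) ≡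
                 segments (diffs A A) (δ x x') (diffs L M) (δ y y') (diffs L' M') (δ z z') (diffs B B)
diffs-segments A {x} {x'} {y} {y'} {z} {z'} {L} {M} {L'} {M'} B |L|≡|M| |L'|≡|M'| =
  trans (diffs-++ (x ∷ _) (x' ∷ _) refl)
    (cong (λ ds → diffs A A ++ δ x x' ∷ ds)
      (trans (diffs-++ (y ∷ _) (y' ∷ _) |L|≡|M|)
        (cong (λ ds → diffs L M ++ δ y y' ∷ ds) (diffs-++ (z ∷ B) (z' ∷ B) |L'|≡|M'|))))

length-segments : ∀ {X : Set} (A : List X) {x x' y y' z z'} {L M L' M'} B →
                  length L ≡ length M → length L' ≡ length M' →
                  length (segments A x L y L' z B) ≡ length (segments A x' M y' M' z' B)
length-segments A {L = L} {M} {L'} {M'} B |L|≡|M| |L'|≡|M'| = begin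
  length (segments A _ L _ L' _ B)                        ≡⟨ LP.length-++ A ⟩
  length A + suc (length (L ++ _ ∷ (L' ++ _ ∷ B)))        ≡⟨ cong (λ n → length A + suc n) (LP.length-++ L) ⟩
  length A + suc (length L + suc (length (L' ++ _ ∷ B)))  ≡⟨ cong (λ n → length A + suc (length L + suc n)) (LP.length-++ L') ⟩
  length A + suc (length L + suc (length L' + suc (length B)))
    ≡⟨ cong₂ (λ l l' → length A + suc (l + suc (l' + suc (length B)))) |L|≡|M| |L'|≡|M'| ⟩
  length A + suc (length M + suc (length M' + suc (length B)))  ≡⟨ cong (λ n → length A + suc (length M + suc n)) (LP.length-++ M') ⟨
  length A + suc (length M + suc (length (M' ++ _ ∷ B)))  ≡⟨ cong (λ n → length A + suc n) (LP.length-++ M) ⟨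
  length A + suc (length (M ++ _ ∷ (M' ++ _ ∷ B)))        ≡⟨ LP.length-++ A ⟨
  length (segments A _ M _ M' _ B)                        ∎
  where open ≡-Reasoning

All-segments : ∀ {X : Set} {P : X → Set} A {x y z} L L' B →
               All P (segments A x L y L' z B) ⇔ (All P A × P x × All P L × P y × All P L' × P z × All P B)
All-segments A {x} {y} {z} L L' B = mk⇔
  (λ all → let PA , Px∷ = AllP.++⁻ A {x ∷ (L ++ y ∷ (L' ++ z ∷ B))} all
               PL , Py∷ = AllP.++⁻ L {y ∷ (L' ++ z ∷ B)} (All.tail Px∷)
               PL' , Pz∷ = AllP.++⁻ L' {z ∷ B} (All.tail Py∷)
           in PA , All.head Px∷ , PL , All.head Py∷ , PL' , All.head Pz∷ , All.tail Pz∷)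
  (λ (PA , Px , PL , Py , PL' , Pz , PB) → AllP.++⁺ PA (Px ∷ AllP.++⁺ PL (Py ∷ AllP.++⁺ PL' (Pz ∷ PB))))

segments-cong : ∀ {X : Set} {A A' : List X} {x x' y y' z z'} {L M L' M' B B'} →
                A ≡ A' → x ≡ x' → L ≡ M → y ≡ y' → L' ≡ M' → z ≡ z' → B ≡ B' →
                segments A x L y L' z B ≡ segments A' x' M y' M' z' B'
segments-cong refl refl refl refl refl refl refl = refl

map-map-++ : ∀ {A B C : Set} (g : B → C) (h : A → B) xs ys →
             map g (map h (xs ++ ys)) ≡ map (g ∘ h) xs ++ map (g ∘ h) ys
map-map-++ g h xs ys = trans (sym (LP.map-∘ (xs ++ ys))) (LP.map-++ (g ∘ h) xs ys)

-- The two depth sequences agree outside the middle, where they are shifted by one leaf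
-- against each other.
module Gadget (m k r : ℕ) where

  Q P left right : STree
  Q     = rightComb r (leftComb (suc r) leaf₁)
  P     = leftComb r (rightComb (suc r) leaf₁)
  left  = rightComb k leaf₁ ⋆ leftComb m Q
  right = rightComb k P ⋆ leftComb m leaf₁

  gₗ : Depth → Depth
  gₗ = stepR ∘ shift (m , 0)
  gᵣ : Depth → Depth
  gᵣ = stepL ∘ shift (0 , k)

  A B : List Depth
  A = map stepL (applyUpTo (1 ,_) k)
  B = map stepR (rightLeaves m)

  x₁ y₁ z₁ x₂ y₂ z₂ : Depth
  x₁ = gᵣ (0 , 0)
  y₁ = gₗ (shift (0 , r) (shift (suc r , 0) (0 , 0)))
  z₁ = gₗ (shift (0 , r) (0 , 1))
  x₂ = gᵣ (shift (r , 0) (1 , 0))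
  y₂ = gᵣ (shift (r , 0) (shift (0 , suc r) (0 , 0)))
  z₂ = gₗ (0 , 0)

  L₁ L₁' L₂ L₂' : List Depth
  L₁  = applyUpTo (λ j → gₗ (1 , j)) r
  L₁' = map (gₗ ∘ shift (0 , r) ∘ stepL) (rightLeaves r)
  L₂  = applyUpTo (λ j → gᵣ (shift (r , 0) (1 , suc j))) r
  L₂' = map gᵣ (rightLeaves r)

  depths-left : depthsₛ left ≡ segments A x₁ L₁ y₁ L₁' z₁ B
  depths-left = begin
    depthsₛ left
      ≡⟨ cong₂ (λ xs ys → map stepL xs ++ map stepR ys) (depths-rightComb k leaf₁) (depths-leftComb m Q) ⟩
    map stepL (applyUpTo (1 ,_) k ++ x₀ ∷ []) ++ map stepR (map (shift (m , 0)) (depthsₛ Q) ++ rightLeaves m)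
      ≡⟨ cong₂ _++_ (LP.map-++ stepL (applyUpTo (1 ,_) k) (x₀ ∷ []))
                    (LP.map-++ stepR (map (shift (m , 0)) (depthsₛ Q)) (rightLeaves m)) ⟩
    (A ++ x₁ ∷ []) ++ (map stepR (map (shift (m , 0)) (depthsₛ Q)) ++ B)
      ≡⟨ LP.++-assoc A (x₁ ∷ []) _ ⟩
    A ++ x₁ ∷ (map stepR (map (shift (m , 0)) (depthsₛ Q)) ++ B)
      ≡⟨ cong (λ xs → A ++ x₁ ∷ (xs ++ B)) middle ⟩
    A ++ x₁ ∷ ((L₁ ++ y₁ ∷ (L₁' ++ z₁ ∷ [])) ++ B)
      ≡⟨ cong (λ xs → A ++ x₁ ∷ xs) (trans (LP.++-assoc L₁ _ B) (cong (λ xs → L₁ ++ y₁ ∷ xs) (LP.++-assoc L₁' _ B))) ⟩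
    segments A x₁ L₁ y₁ L₁' z₁ B ∎
    where
    open ≡-Reasoning
    x₀ = shift (0 , k) (0 , 0)
    q₀ = shift (suc r , 0) (0 , 0)
    depths-Q : depthsₛ Q ≡ applyUpTo (1 ,_) r ++ map (shift (0 , r)) (q₀ ∷ map stepL (rightLeaves r) ++ (0 , 1) ∷ [])
    depths-Q = trans (depths-rightComb r _)
                     (cong (λ xs → applyUpTo (1 ,_) r ++ map (shift (0 , r)) xs) (depths-leftComb (suc r) leaf₁))
    middle : map stepR (map (shift (m , 0)) (depthsₛ Q)) ≡ L₁ ++ y₁ ∷ (L₁' ++ z₁ ∷ [])
    middle = begin
      map stepR (map (shift (m , 0)) (depthsₛ Q))
        ≡⟨ LP.map-∘ (depthsₛ Q) ⟨
      map gₗ (depthsₛ Q)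
        ≡⟨ cong (map gₗ) depths-Q ⟩
      map gₗ (applyUpTo (1 ,_) r ++ map (shift (0 , r)) (q₀ ∷ map stepL (rightLeaves r) ++ (0 , 1) ∷ []))
        ≡⟨ LP.map-++ gₗ (applyUpTo (1 ,_) r) _ ⟩
      map gₗ (applyUpTo (1 ,_) r) ++ y₁ ∷ map gₗ (map (shift (0 , r)) (map stepL (rightLeaves r) ++ (0 , 1) ∷ []))
        ≡⟨ cong₂ (λ xs ys → xs ++ y₁ ∷ ys) (LP.map-applyUpTo (1 ,_) gₗ r)
                 (trans (map-map-++ gₗ (shift (0 , r)) (map stepL (rightLeaves r)) ((0 , 1) ∷ []))
                        (cong (_++ z₁ ∷ []) (sym (LP.map-∘ (rightLeaves r))))) ⟩
      L₁ ++ y₁ ∷ (L₁' ++ z₁ ∷ []) ∎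

  depths-right : depthsₛ right ≡ segments A x₂ L₂ y₂ L₂' z₂ B
  depths-right = begin
    depthsₛ right
      ≡⟨ cong₂ (λ xs ys → map stepL xs ++ map stepR ys) (depths-rightComb k P) (depths-leftComb m leaf₁) ⟩
    map stepL (applyUpTo (1 ,_) k ++ map (shift (0 , k)) (depthsₛ P)) ++ z₂ ∷ B
      ≡⟨ cong (_++ z₂ ∷ B) (map-++-map stepL (shift (0 , k)) (applyUpTo (1 ,_) k) (depthsₛ P)) ⟩
    (A ++ map gᵣ (depthsₛ P)) ++ z₂ ∷ B
      ≡⟨ cong (λ xs → (A ++ xs) ++ z₂ ∷ B) middle ⟩
    (A ++ x₂ ∷ (L₂ ++ y₂ ∷ L₂')) ++ z₂ ∷ B
      ≡⟨ trans (LP.++-assoc A _ _) (cong (λ xs → A ++ x₂ ∷ xs) (LP.++-assoc L₂ (y₂ ∷ L₂') (z₂ ∷ B))) ⟩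
    segments A x₂ L₂ y₂ L₂' z₂ B ∎
    where
    open ≡-Reasoning
    map-++-map : ∀ (g h : Depth → Depth) xs ys → map g (xs ++ map h ys) ≡ map g xs ++ map (g ∘ h) ys
    map-++-map g h xs ys = trans (LP.map-++ g xs (map h ys)) (cong (map g xs ++_) (sym (LP.map-∘ ys)))
    p₀ = shift (0 , suc r) (0 , 0)
    depths-P : depthsₛ P ≡ map (shift (r , 0)) ((1 , 0) ∷ applyUpTo (λ j → 1 , suc j) r ++ p₀ ∷ []) ++ rightLeaves r
    depths-P = trans (depths-leftComb r _)
                     (cong (λ xs → map (shift (r , 0)) xs ++ rightLeaves r) (depths-rightComb (suc r) leaf₁))
    middle : map gᵣ (depthsₛ P) ≡ x₂ ∷ (L₂ ++ y₂ ∷ L₂')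
    middle = begin
      map gᵣ (depthsₛ P)
        ≡⟨ cong (map gᵣ) depths-P ⟩
      map gᵣ (map (shift (r , 0)) ((1 , 0) ∷ applyUpTo (λ j → 1 , suc j) r ++ p₀ ∷ []) ++ rightLeaves r)
        ≡⟨ LP.map-++ gᵣ (map (shift (r , 0)) ((1 , 0) ∷ _)) (rightLeaves r) ⟩
      x₂ ∷ map gᵣ (map (shift (r , 0)) (applyUpTo (λ j → 1 , suc j) r ++ p₀ ∷ [])) ++ L₂'
        ≡⟨ cong (λ xs → x₂ ∷ xs ++ L₂') (map-map-++ gᵣ (shift (r , 0)) (applyUpTo (λ j → 1 , suc j) r) _) ⟩
      x₂ ∷ (map (gᵣ ∘ shift (r , 0)) (applyUpTo (λ j → 1 , suc j) r) ++ y₂ ∷ []) ++ L₂'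
        ≡⟨ cong (λ xs → x₂ ∷ (xs ++ y₂ ∷ []) ++ L₂') (LP.map-applyUpTo (λ j → 1 , suc j) (gᵣ ∘ shift (r , 0)) r) ⟩
      x₂ ∷ (L₂ ++ y₂ ∷ []) ++ L₂'
        ≡⟨ cong (x₂ ∷_) (LP.++-assoc L₂ (y₂ ∷ []) L₂') ⟩
      x₂ ∷ (L₂ ++ y₂ ∷ L₂') ∎

  d₁ d₂ d₃ d₄ d₅ : ℤ²
  d₁ = δ (0 , 0) (suc r , 0)
  d₂ = δ (m , 0) (suc r , k)
  d₃ = δ (m , 0) (0 , k)
  d₄ = δ (m , suc r) (0 , k)
  d₅ = δ (0 , suc r) (0 , 0)

  δ-x : δ x₁ x₂ ≡ d₁
  δ-x = δ-cong x₁ x₂ 0 0 (suc r) 0 (cong suc (ℕP.+-comm 1 r)) (ℕP.+-identityʳ (k + 0))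

  δ-L : ∀ j → δ (gₗ (1 , j)) (gᵣ (shift (r , 0) (1 , suc j))) ≡ d₂
  δ-L j = δ-cong (gₗ (1 , j)) (gᵣ (shift (r , 0) (1 , suc j))) m 0 (suc r) k
    (trans (ℕP.+-assoc m 1 (suc r)) (cong (λ n → m + suc n) (ℕP.+-comm 1 r))) (ℕP.+-comm (suc j) k)

  δ-y : δ y₁ y₂ ≡ d₃
  δ-y = δ-cong y₁ y₂ m 0 0 k (ℕP.+-identityʳ _) (ℕP.+-comm (suc (r + 0)) k)

  δ-L' : ∀ z → δ ((gₗ ∘ shift (0 , r) ∘ stepL) z) (gᵣ z) ≡ d₄
  δ-L' z@(a , b) = δ-cong ((gₗ ∘ shift (0 , r) ∘ stepL) z) (gᵣ z) m (suc r) 0 k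
    (ℕP.+-identityʳ _) (cong suc (trans (ℕP.+-assoc r b k) (cong (λ n → r + n) (ℕP.+-comm b k))))

  δ-z : δ z₁ z₂ ≡ d₅
  δ-z = δ-cong z₁ z₂ 0 (suc r) 0 0 (ℕP.+-identityʳ (m + 0)) (ℕP.+-identityʳ (suc (r + 1)))

  gadgetDiffs : List ℤ²
  gadgetDiffs = segments (replicate k origin) d₁ (replicate r d₂) d₃ (replicate r d₄) d₅ (replicate m origin)

  length-L : length L₁ ≡ length L₂
  length-L = trans (LP.length-applyUpTo _ r) (sym (LP.length-applyUpTo _ r))

  length-L' : length L₁' ≡ length L₂'
  length-L' = trans (LP.length-map _ (rightLeaves r)) (sym (LP.length-map _ (rightLeaves r)))

  length-depths : length (depthsₛ left) ≡ length (depthsₛ right)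
  length-depths = begin
    length (depthsₛ left)                    ≡⟨ cong length depths-left ⟩
    length (segments A x₁ L₁ y₁ L₁' z₁ B)  ≡⟨ length-segments A B length-L length-L' ⟩
    length (segments A x₂ L₂ y₂ L₂' z₂ B)  ≡⟨ cong length depths-right ⟨
    length (depthsₛ right)                   ∎
    where open ≡-Reasoning

  diffs-gadget : diffs (depthsₛ left) (depthsₛ right) ≡ gadgetDiffs
  diffs-gadget = begin
    diffs (depthsₛ left) (depthsₛ right)
      ≡⟨ cong₂ diffs depths-left depths-right ⟩
    diffs (segments A x₁ L₁ y₁ L₁' z₁ B) (segments A x₂ L₂ y₂ L₂' z₂ B)
      ≡⟨ diffs-segments A B length-L length-L' ⟩
    segments (diffs A A) (δ x₁ x₂) (diffs L₁ L₂) (δ y₁ y₂) (diffs L₁' L₂') (δ z₁ z₂) (diffs B B)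
      ≡⟨ segments-cong (zeros A (trans (LP.length-map stepL (applyUpTo (1 ,_) k)) (LP.length-applyUpTo (1 ,_) k))) δ-x
                       (diffs-applyUpTo δ-L r) δ-y
                       (trans (diffs-map-const δ-L' (rightLeaves r)) (cong (λ n → replicate n d₄) (length-rightLeaves r)))
                       δ-z (zeros B (trans (LP.length-map stepR (rightLeaves m)) (length-rightLeaves m))) ⟩
    gadgetDiffs ∎
    where
    open ≡-Reasoning
    zeros : ∀ xs {n} → length xs ≡ n → diffs xs xs ≡ replicate n origin
    zeros xs eq = trans (diffs-self xs) (cong (λ n → replicate n origin) eq)

  -- d₁ = −e₁, d₂ = U − e₁, d₃ = U, d₄ = U + e₂, d₅ = e₂ for U = posNeg m k and eᵢ = axisᵢ (suc r).
  gadget-closure : ∀ Λ → All (mem Λ) gadgetDiffs ⇔ (mem Λ (posNeg m k) × mem Λ (axis₁ (suc r)) × mem Λ (axis₂ (suc r)))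
  gadget-closure Λ = mk⇔
    (λ all → let _ , d₁∈ , _ , d₃∈ , _ , d₅∈ , _ = Equivalence.to (All-segments _ _ _ _) all
             in subst (mem Λ) d₃≡U d₃∈ , mem-neg Λ d₁∈ , subst (mem Λ) d₅≡e₂ d₅∈)
    (λ (U∈ , e₁∈ , e₂∈) → Equivalence.from (All-segments _ _ _ _)
       ( AllP.replicate⁺ k (mem-zero Λ)
       , mem-neg Λ e₁∈
       , AllP.replicate⁺ r (subst (mem Λ) (sym d₂≡U-e₁) (mem-add Λ U∈ (mem-neg Λ e₁∈)))
       , subst (mem Λ) (sym d₃≡U) U∈
       , AllP.replicate⁺ r (subst (mem Λ) (sym d₄≡U+e₂) (mem-add Λ U∈ e₂∈))
       , subst (mem Λ) (sym d₅≡e₂) e₂∈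
       , AllP.replicate⁺ m (mem-zero Λ)))
    where
    d₃≡U : d₃ ≡ posNeg m k
    d₃≡U = cong₂ _,_ (ℤP.+-identityʳ (+ m)) (ℤP.+-identityˡ (-ℤ + k))
    d₅≡e₂ : d₅ ≡ axis₂ (suc r)
    d₅≡e₂ = cong (0ℤ ,_) (ℤP.+-identityʳ (+ suc r))
    d₂≡U-e₁ : d₂ ≡ posNeg m k ⊕ (⊖ axis₁ (suc r))
    d₂≡U-e₁ = cong (_ ,_) (trans (ℤP.+-identityˡ (-ℤ + k)) (sym (ℤP.+-identityʳ (-ℤ + k))))
    d₄≡U+e₂ : d₄ ≡ posNeg m k ⊕ axis₂ (suc r)
    d₄≡U+e₂ = cong (_ ,_) (ℤP.+-comm (+ suc r) (-ℤ + k))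

length-⋆ : ∀ X Y X' Y' → length (depthsₛ X) ≡ length (depthsₛ X') → length (depthsₛ Y) ≡ length (depthsₛ Y') →
           length (depthsₛ (X ⋆ Y)) ≡ length (depthsₛ (X' ⋆ Y'))
length-⋆ (a , l) (b , r) (a' , l') (b' , r') |l|≡|l'| |r|≡|r'| = begin
  length (depthList (node l r))                          ≡⟨ length-depthList (node l r) ⟩
  a + b                                                  ≡⟨ cong₂ _+_ (sym (length-depthList l)) (sym (length-depthList r)) ⟩
  length (depthList l) + length (depthList r)            ≡⟨ cong₂ _+_ |l|≡|l'| |r|≡|r'| ⟩
  length (depthList l') + length (depthList r')          ≡⟨ cong₂ _+_ (length-depthList l') (length-depthList r') ⟩
  a' + b'                                                ≡⟨ length-depthList (node l' r') ⟨
  length (depthList (node l' r'))                        ∎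
  where open ≡-Reasoning

trivial⇒Treealisable : (Λ : Subgroup) → Trivial Λ → Treealisable Λ
trivial⇒Treealisable Λ trivial = 0 , leaf , leaf , λ w → mk⇔
  (λ w∈Λ → subst (mem Λ[ leaf , leaf ]) (sym (Equivalence.to (trivial w) w∈Λ)) gzero)
  (λ w∈Λ₀ → Equivalence.from (trivial w) (⟨⟩-least zeroSubgroup (λ { zero → refl }) w∈Λ₀))

module GadgetFor (r : ℕ) (w : ℤ²) = Gadget (lift r (proj₁ w)) (lift r (-ℤ proj₂ w)) r

GadgetFor-closure : ∀ r w Λ →
                    All (mem Λ) (GadgetFor.gadgetDiffs r w) ⇔ (mem Λ w × mem Λ (axis₁ (suc r)) × mem Λ (axis₂ (suc r)))
GadgetFor-closure r w Λ = mk⇔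
  (λ all → let U∈ , e₁∈ , e₂∈ = Equivalence.to (GadgetFor.gadget-closure r w Λ) all
           in Equivalence.from (representative-mem Λ r w e₁∈ e₂∈) U∈ , e₁∈ , e₂∈)
  (λ (w∈ , e₁∈ , e₂∈) →
     Equivalence.from (GadgetFor.gadget-closure r w Λ) (Equivalence.to (representative-mem Λ r w e₁∈ e₂∈) w∈ , e₁∈ , e₂∈))

twoDimensional⇒Treealisable : (Λ : Subgroup) → TwoDimensional Λ → Treealisable Λ
twoDimensional⇒Treealisable Λ (u , v , det≢0 , Λ≐span) =
  treealisable-by {Λ} (proj₂ T) (proj₂ T')
    (length-⋆ Gu.left Gv.left Gu.right Gv.right Gu.length-depths Gv.length-depths)
    (≐-trans {Λ} {span₂ u v} {Span (treeDiffs (proj₂ T) (proj₂ T'))} Λ≐span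
       (≐-sym {Span (treeDiffs (proj₂ T) (proj₂ T'))} {span₂ u v} (Span≐span₂ same)))
  where
  r : ℕ
  r = proj₁ (full-sublattice u v det≢0)
  module Gu = GadgetFor r u
  module Gv = GadgetFor r v
  T T' : STree
  T  = Gu.left ⋆ Gv.left
  T' = Gu.right ⋆ Gv.right
  diffs≡ : treeDiffs (proj₂ T) (proj₂ T') ≡ Gu.gadgetDiffs ++ Gv.gadgetDiffs
  diffs≡ = trans (diffs-node (proj₂ Gu.left) (proj₂ Gv.left) (proj₂ Gu.right) (proj₂ Gv.right) Gu.length-depths)
                 (cong₂ _++_ Gu.diffs-gadget Gv.diffs-gadget)
  same : ∀ Λ' → All (mem Λ') (treeDiffs (proj₂ T) (proj₂ T')) ⇔ mem₂ Λ' (u , v)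
  same Λ' = mk⇔
    (λ all → let all-u , all-v = AllP.++⁻ Gu.gadgetDiffs (subst (All (mem Λ')) diffs≡ all)
             in proj₁ (Equivalence.to (GadgetFor-closure r u Λ') all-u) ,
                proj₁ (Equivalence.to (GadgetFor-closure r v Λ') all-v))
    (λ (u∈ , v∈) → let e₁∈ , e₂∈ = proj₂ (full-sublattice u v det≢0) Λ' (u∈ , v∈)
                   in subst (All (mem Λ')) (sym diffs≡)
                        (AllP.++⁺ (Equivalence.from (GadgetFor-closure r u Λ') (u∈ , e₁∈ , e₂∈))
                                  (Equivalence.from (GadgetFor-closure r v Λ') (v∈ , e₁∈ , e₂∈))))

theorem5p16 : (Λ : Subgroup) → (Treealisable Λ → TwoDimensional Λ ⊎ Trivial Λ) × (TwoDimensional Λ ⊎ Trivial Λ → Treealisable Λ)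
theorem5p16 Λ = treealisable⇒ Λ , [ twoDimensional⇒Treealisable Λ , trivial⇒Treealisable Λ ]′
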